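{- Let $n\geq 2$ be an integer. Regard $\boldsymbol{X}_n^\infty$ as consisting of copies $X^{(j)}=\{a_1^{(j)},\dots,a_n^{(j)},b_1^{(j)},\dots,b_n^{(j)}\}$ of $\boldsymbol{X}_n$, $j\in\omega$, together with the top $\top$. Let $R_n$ be the equivalence relation on $\boldsymbol{X}_n^\infty$ whose non-singleton classes are exactly the sets $\{a_m^{(j)},b_m^{(j)}\}$ for $j\in\omega$ and $2\leq m\leq n$, and $\{b_1^{(j)},a_1^{(j+1)}\}$ for $j\in\omega$. Then $R_n$ is a correct partition on $\boldsymbol{X}_n^\infty$.
   Context: An Esakia space is a Stone space with a partial order such that ${\uparrow}x$ is closed for every $x$ and ${\downarrow}U$ is clopen for every clopen $U$. A correct partition on an Esakia space $\boldsymbol{X}$ is an equivalence relation $R$ on $X$ such that (i) if $\langle x,y\rangle\in R$ and $x\leq z$, then $\langle z,w\rangle\in R$ for some $w\geq y$; and (ii) if $\langle x,y\rangle\notin R$, there is a clopen set $U$ that is a union of $R$-classes with $x\in U$, $y\notin U$. For $n\geq 2$, $\boldsymbol{X}_n$ is the poset with universe $\{a_1,\dots,a_n,b_1,\dots,b_n\}$ where $x\leq y$ iff $x=y$, or $x=a_1$ and $y\in\{b_2,\dots,b_n\}$, or $x=a_m$ for some $m>1$ and $y\in\{b_1,b_m\}$, with the discrete topology. $\boldsymbol{X}_n^\infty$ has universe $\{\top\}\cup\bigcup_{j\in\omega}X^{(j)}$, with order $x\leq y$ iff $y=\top$, or $x,y$ in the same copy and $x\leq y$ there, or $x\in X^{(j)}$,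 $y\in X^{(k)}$ with $j<k$; its open sets are those $U$ (every subset of $\bigcup_jX^{(j)}$ being open in each copy) such that if $\top\in U$ then $\bigcup_{k\geq j}X^{(k)}\subseteq U$ for some $j$. -}

module Defs where

open import Data.Nat using (ℕ; zero; suc; _<_; _≤_)
open import Data.Fin using (Fin; toℕ)
open import Data.Product using (_×_; ∃-syntax)
open import Relation.Binary.PropositionalEquality using (_≡_)
open import Relation.Binary.Structures using (IsEquivalence)
open import Relation.Nullary using (¬_)
open import Relation.Unary using (Pred; _∈_; _∉_; ∁)
open import Level using (0ℓ)

Saturated : {X : Set} → (X → X → Set) → Pred X 0ℓ → Set
Saturated {X} R U = ∀ {x y : X} → R x y → x ∈ U → y ∈ U

record CorrectPartition (X : Set) (_≤X_ : X → X → Set)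
                        (Clopen : Pred X 0ℓ → Set) (R : X → X → Set) : Set₁ where
  field
    isEquivalence : IsEquivalence R
    upward : ∀ {x y z} → R x y → x ≤X z → ∃[ w ] (y ≤X w × R z w)
    separate : ∀ {x y} → ¬ R x y →
      ∃[ U ] (Clopen U × Saturated R U × x ∈ U × y ∉ U)

-- The poset X_n : points a_m, b_m with m : Fin n; the index i : Fin n
-- stands for m = toℕ i + 1, so IsOne i means m = 1.

IsOne : {n : ℕ} → Fin n → Set
IsOne i = toℕ i ≡ 0

data Xn (n : ℕ) : Set where
  a b : Fin n → Xn n

data _≤n_ {n : ℕ} : Xn n → Xn n → Set where
  ≤n-refl : ∀ {x} → x ≤n x
  a₁≤bₘ   : ∀ (o m : Fin n) → IsOne o → ¬ IsOne m → a o ≤n b m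
  aₘ≤b₁   : ∀ (o m : Fin n) → IsOne o → ¬ IsOne m → a m ≤n b o
  aₘ≤bₘ   : ∀ (m : Fin n) → ¬ IsOne m → a m ≤n b m

data X∞ (n : ℕ) : Set where
  ⊤ : X∞ n
  [_,_] : ℕ → Xn n → X∞ n

data _≤∞_ {n : ℕ} : X∞ n → X∞ n → Set where
  ≤-top  : ∀ {x} → x ≤∞ ⊤
  ≤-copy : ∀ {j x y} → x ≤n y → [ j , x ] ≤∞ [ j , y ]
  ≤-lower : ∀ {j k x y} → j < k → [ j , x ] ≤∞ [ k , y ]

IsOpen∞ : {n : ℕ} → Pred (X∞ n) 0ℓ → Set
IsOpen∞ {n} U = ⊤ ∈ U → ∃[ j ] (∀ k → j ≤ k → ∀ (x : Xn n) → [ k , x ] ∈ U)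

IsClopen∞ : {n : ℕ} → Pred (X∞ n) 0ℓ → Set
IsClopen∞ U = IsOpen∞ U × IsOpen∞ (∁ U)

data Rn {n : ℕ} : X∞ n → X∞ n → Set where
  R-refl  : ∀ {x} → Rn x x
  R-ab    : ∀ j (m : Fin n) → ¬ IsOne m → Rn [ j , a m ] [ j , b m ]
  R-ba    : ∀ j (m : Fin n) → ¬ IsOne m → Rn [ j , b m ] [ j , a m ]
  R-b₁a₁  : ∀ j (o : Fin n) → IsOne o → Rn [ j , b o ] [ suc j , a o ]
  R-a₁b₁  : ∀ j (o : Fin n) → IsOne o → Rn [ suc j , a o ] [ j , b o ]

-- Every R_n-class is a finite set {x}, {a_m^(j), b_m^(j)} or
-- {b_1^(j), a_1^(j+1)}; in particular the class of a point of the copy X^(j)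
-- lies inside X^(j) ∪ X^(j+1) (`class-bounded`).
--  * R_n is an equivalence relation, by inspection of the constructors.
--  * Condition (i) is checked class by class.  The only non-trivial case is
--    b_1^(j) R a_1^(j+1) with z a point of X^(j+1): there we use that every
--    class meeting X^(j+1) has a member above a_1^(j+1) (`above-a₁`).
--  * Condition (ii): for a point x of some copy, its class [x] is saturated
--    (true for any equivalence relation) and clopen, since it avoids ⊤ and
--    misses all copies X^(k), k ≥ j+2.  So [x] separates x from any y outside
--    it, and its complement separates ⊤ from x.
module Submission where

open import Defs
open import Data.Nat using (ℕ; suc; _≤_; _≟_)
open import Data.Nat.Properties using (n<1+n; <-trans; m≤n⇒m<n∨m≡n; ≤-refl; n≤1+n; m≤n⇒m≤1+n; <⇒≱)
open import Data.Fin using (Fin; toℕ)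
open import Data.Fin.Properties using (toℕ-injective)
open import Data.Product using (_×_; _,_; proj₂; ∃-syntax)
open import Data.Sum using (inj₁; inj₂)
open import Data.Empty using (⊥-elim)
open import Relation.Nullary using (¬_; yes; no)
open import Relation.Unary using (Pred; _∈_; _∉_; ∁)
open import Relation.Binary.PropositionalEquality using (_≡_; refl; sym; trans)
open import Relation.Binary.Structures using (IsEquivalence)
open import Level using (0ℓ)

module _ {X : Set} {R : X → X → Set} (isEq : IsEquivalence R) where
  open IsEquivalence isEq renaming (sym to R-sym; trans to R-trans)

  class-saturated : (x : X) → Saturated R (R x)
  class-saturated x yRz xRy = R-trans xRy yRz

  complement-saturated : {U : Pred X 0ℓ} → Saturated R U → Saturated R (∁ U)
  complement-saturated satU yRz y∉U z∈U = y∉U (satU (R-sym yRz) z∈U)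

IsOne-unique : {n : ℕ} {i j : Fin n} → IsOne i → IsOne j → i ≡ j
IsOne-unique i≡0 j≡0 = toℕ-injective (trans i≡0 (sym j≡0))

module _ {n : ℕ} where

  Rn-sym : {x y : X∞ n} → Rn x y → Rn y x
  Rn-sym R-refl           = R-refl
  Rn-sym (R-ab j m m≢1)   = R-ba j m m≢1
  Rn-sym (R-ba j m m≢1)   = R-ab j m m≢1
  Rn-sym (R-b₁a₁ j o o≡1) = R-a₁b₁ j o o≡1
  Rn-sym (R-a₁b₁ j o o≡1) = R-b₁a₁ j o o≡1

  -- Two steps inside a two-element class return to the start; the only
  -- other composites would need an index that both is and is not 1.
  Rn-trans : {x y z : X∞ n} → Rn x y → Rn y z → Rn x z
  Rn-trans R-refl r = r
  Rn-trans r R-refl = r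
  Rn-trans (R-ab _ _ _)          (R-ba _ _ _)        = R-refl
  Rn-trans (R-ab _ _ m≢1)        (R-b₁a₁ _ _ m≡1)    = ⊥-elim (m≢1 m≡1)
  Rn-trans (R-ba _ _ _)          (R-ab _ _ _)        = R-refl
  Rn-trans (R-ba _ _ m≢1)        (R-a₁b₁ _ _ m≡1)    = ⊥-elim (m≢1 m≡1)
  Rn-trans (R-b₁a₁ _ _ o≡1)      (R-ab _ _ o≢1)      = ⊥-elim (o≢1 o≡1)
  Rn-trans (R-b₁a₁ _ _ _)        (R-a₁b₁ _ _ _)      = R-refl
  Rn-trans (R-a₁b₁ _ _ o≡1)      (R-ba _ _ o≢1)      = ⊥-elim (o≢1 o≡1)
  Rn-trans (R-a₁b₁ _ _ _)        (R-b₁a₁ _ _ _)      = R-refl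

  Rn-isEquivalence : IsEquivalence (Rn {n})
  Rn-isEquivalence = record { refl = R-refl ; sym = Rn-sym ; trans = Rn-trans }

  class-bounded : ∀ {j k u v} → Rn {n} [ j , u ] [ k , v ] → k ≤ suc j
  class-bounded R-refl         = n≤1+n _
  class-bounded (R-ab _ _ _)   = n≤1+n _
  class-bounded (R-ba _ _ _)   = n≤1+n _
  class-bounded (R-b₁a₁ _ _ _) = ≤-refl
  class-bounded (R-a₁b₁ _ _ _) = m≤n⇒m≤1+n (n≤1+n _)

  class-misses-far-copies : ∀ {j k u v} → suc (suc j) ≤ k → ¬ Rn {n} [ j , u ] [ k , v ]
  class-misses-far-copies j+2≤k r = <⇒≱ j+2≤k (class-bounded r)

  -- The class of a point of a copy is clopen: it avoids ⊤, and its
  -- complement contains ⊤ together with all copies from j+2 on.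
  class-clopen : ∀ j u → IsClopen∞ (Rn {n} [ j , u ])
  class-clopen j u = (λ ()) , λ _ → suc (suc j) , λ _ j+2≤k _ → class-misses-far-copies j+2≤k

  -- Every class meeting X^(k) has a member above a_1^(k): a_1 ≤ b_m (m ≥ 2)
  -- in X^(k), the class of a_m is {a_m, b_m}, and b_1^(k) R a_1^(k+1).
  above-a₁ : ∀ k (o : Fin n) → IsOne o → (v : Xn n) →
             ∃[ w ] ([ k , a o ] ≤∞ w × Rn [ k , v ] w)
  above-a₁ k o o≡1 (a m) with toℕ m ≟ 0
  ... | yes m≡1 rewrite IsOne-unique m≡1 o≡1 = [ k , a o ] , ≤-copy ≤n-refl , R-refl
  ... | no m≢1 = [ k , b m ] , ≤-copy (a₁≤bₘ o m o≡1 m≢1) , R-ab k m m≢1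
  above-a₁ k o o≡1 (b m) with toℕ m ≟ 0
  ... | yes m≡1 = [ suc k , a m ] , ≤-lower (n<1+n k) , R-b₁a₁ k m m≡1
  ... | no m≢1 = [ k , b m ] , ≤-copy (a₁≤bₘ o m o≡1 m≢1) , R-refl

  upward : ∀ {x y z : X∞ n} → Rn x y → x ≤∞ z → ∃[ w ] (y ≤∞ w × Rn z w)
  upward {z = z} R-refl x≤z = z , x≤z , R-refl
  upward _ ≤-top = ⊤ , ≤-top , R-refl
  upward (R-ab j m m≢1) (≤-copy ≤n-refl)            = [ j , b m ] , ≤-copy ≤n-refl , R-ab j m m≢1
  upward (R-ab _ _ m≢1) (≤-copy (a₁≤bₘ _ _ m≡1 _))  = ⊥-elim (m≢1 m≡1)
  upward (R-ab j _ _)   (≤-copy (aₘ≤b₁ o _ o≡1 _))  = [ suc j , a o ] , ≤-lower (n<1+n j) , R-b₁a₁ j o o≡1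
  upward (R-ab j m _)   (≤-copy (aₘ≤bₘ _ _))        = [ j , b m ] , ≤-copy ≤n-refl , R-refl
  upward (R-ab _ _ _)   (≤-lower j<k)               = _ , ≤-lower j<k , R-refl
  -- x = b_m^(j), y = a_m^(j), m ≥ 2: b_m is maximal in X^(j)
  upward (R-ba j m m≢1) (≤-copy ≤n-refl)            = [ j , b m ] , ≤-copy (aₘ≤bₘ m m≢1) , R-refl
  upward (R-ba _ _ _)   (≤-lower j<k)               = _ , ≤-lower j<k , R-refl
  -- x = a_1^(j+1), y = b_1^(j): everything above x lies above y
  upward (R-a₁b₁ j _ _)   (≤-copy _)                = _ , ≤-lower (n<1+n j) , R-refl
  upward (R-a₁b₁ j _ _)   (≤-lower j+1<k)           = _ , ≤-lower (<-trans (n<1+n j) j+1<k) , R-refl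
  upward (R-b₁a₁ j o o≡1) (≤-copy ≤n-refl)          = [ suc j , a o ] , ≤-copy ≤n-refl , R-b₁a₁ j o o≡1
  upward (R-b₁a₁ j o o≡1) (≤-lower {y = v} j<k) with m≤n⇒m<n∨m≡n j<k
  ... | inj₁ j+1<k  = _ , ≤-lower j+1<k , R-refl
  ... | inj₂ refl   = above-a₁ (suc j) o o≡1 v

  separate : ∀ {x y : X∞ n} → ¬ Rn x y →
             ∃[ U ] (IsClopen∞ U × Saturated Rn U × x ∈ U × y ∉ U)
  separate {⊤} {⊤} ¬xRy = ⊥-elim (¬xRy R-refl)
  separate {⊤} {[ j , u ]} ¬xRy =
    ∁ (Rn [ j , u ]) ,
    (proj₂ (class-clopen j u) , λ ⊤∈∁U → ⊥-elim (⊤∈∁U (λ ()))) ,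
    complement-saturated Rn-isEquivalence (class-saturated Rn-isEquivalence [ j , u ]) ,
    (λ ()) , (λ y∉U → y∉U R-refl)
  separate {[ j , u ]} ¬xRy =
    Rn [ j , u ] , class-clopen j u ,
    class-saturated Rn-isEquivalence [ j , u ] , R-refl , ¬xRy

lemma6p4 : (n : ℕ) → 2 ≤ n →
    CorrectPartition (X∞ n) _≤∞_ IsClopen∞ Rn
lemma6p4 n _ = record
  { isEquivalence = Rn-isEquivalence
  ; upward        = upward
  ; separate      = separate
  }
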